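{- Let $n\ge 4$. For every $\mathbf{x}\in\mathbb{F}_2^n$, $s_3(\mathbf{x}):=|\mathbf{x}|+|\partial\mathbf{x}|+|\partial^2\mathbf{x}|\le 2n-2$.
   Context: For $\mathbf{x}=(x_0,\ldots,x_{n-1})\in\mathbb{F}_2^n$, the derivative is $\partial\mathbf{x}=(x_0+x_1,\ldots,x_{n-2}+x_{n-1})\in\mathbb{F}_2^{n-1}$, and $\partial^2\mathbf{x}=\partial(\partial\mathbf{x})$. $|\mathbf{y}|$ denotes the number of ones of a binary sequence $\mathbf{y}$. -}

module Defs where

open import Data.Bool using (Bool; true; false; _xor_)
open import Data.Nat using (ℕ; zero; suc; _+_)
open import Data.Vec using (Vec; []; _∷_)

-- Elements of F_2^n are modelled as Vec Bool n; addition in F_2 is xor.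

-- Derivative: ∂(x₀,…,x_{n-1}) = (x₀+x₁, …, x_{n-2}+x_{n-1}) ∈ F_2^{n-1}.
-- (For n = 0 we return the empty vector; irrelevant for n ≥ 4.)
∂ : ∀ {n} → Vec Bool n → Vec Bool (Data.Nat.pred n)
∂ [] = []
∂ (x ∷ []) = []
∂ (x ∷ y ∷ xs) = (x xor y) ∷ ∂ (y ∷ xs)

weight : ∀ {n} → Vec Bool n → ℕ
weight [] = 0
weight (true ∷ xs) = suc (weight xs)
weight (false ∷ xs) = weight xs

s₃ : ∀ {n} → Vec Bool n → ℕ
s₃ x = weight x + weight (∂ x) + weight (∂ (∂ x))

module Submission where

open import Defs
open import Data.Bool using (Bool; true; false; _xor_)
open import Data.Nat using (ℕ; suc; _+_; _≤_; _*_; _∸_; s≤s)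
open import Data.Nat.Properties
  using (≤ᵇ⇒≤; m≤n+m; +-monoˡ-≤; +-monoʳ-≤; *-suc; m+n∸m≡n; module ≤-Reasoning)
open import Data.Nat.Tactic.RingSolver using (solve-∀)
open import Data.Unit using (tt)
open import Data.Vec using (Vec; []; _∷_)
open import Relation.Binary.PropositionalEquality using (_≡_; refl; cong; sym)

-- Scanning x from the left, the first coordinate contributes at most 2 to s₃
-- unless x starts with 1 0 0, when it contributes 3.  That excess is paid for
-- by a potential of 1 on sequences starting with 0 0: the potential is created
-- exactly when the contribution is 3, so column contribution plus potential
-- lost never exceeds 2.  A length-2 sequence has s₃ plus potential at most 2,
-- giving s₃ x ≤ 2n − 2 already for n ≥ 2.

bit : Bool → ℕ
bit true = 1
bit false = 0

weight-∷ : ∀ {n} (a : Bool) (xs : Vec Bool n) → weight (a ∷ xs) ≡ bit a + weight xs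
weight-∷ true xs = refl
weight-∷ false xs = refl

column : Bool → Bool → Bool → ℕ
column a b c = bit a + bit (a xor b) + bit ((a xor b) xor (b xor c))

s₃-∷ : ∀ {m} (a b c : Bool) (r : Vec Bool m) →
       s₃ (a ∷ b ∷ c ∷ r) ≡ column a b c + s₃ (b ∷ c ∷ r)
s₃-∷ a b c r
  rewrite weight-∷ a (b ∷ c ∷ r)
        | weight-∷ (a xor b) (∂ (b ∷ c ∷ r))
        | weight-∷ ((a xor b) xor (b xor c)) (∂ (∂ (b ∷ c ∷ r)))
  = regroup (bit a) (bit (a xor b)) (bit ((a xor b) xor (b xor c)))
            (weight (b ∷ c ∷ r)) (weight (∂ (b ∷ c ∷ r))) (weight (∂ (∂ (b ∷ c ∷ r))))
  where
  regroup : ∀ x y z u v w → (x + u) + (y + v) + (z + w) ≡ (x + y + z) + (u + v + w)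
  regroup = solve-∀

doubleZero : Bool → Bool → ℕ
doubleZero false false = 1
doubleZero _ _ = 0

column+doubleZero≤ : ∀ a b c → column a b c + doubleZero a b ≤ 2 + doubleZero b c
column+doubleZero≤ true  true  true  = ≤ᵇ⇒≤ _ _ tt
column+doubleZero≤ true  true  false = ≤ᵇ⇒≤ _ _ tt
column+doubleZero≤ true  false true  = ≤ᵇ⇒≤ _ _ tt
column+doubleZero≤ true  false false = ≤ᵇ⇒≤ _ _ tt
column+doubleZero≤ false true  true  = ≤ᵇ⇒≤ _ _ tt
column+doubleZero≤ false true  false = ≤ᵇ⇒≤ _ _ tt
column+doubleZero≤ false false true  = ≤ᵇ⇒≤ _ _ tt
column+doubleZero≤ false false false = ≤ᵇ⇒≤ _ _ tt

doubleZero+s₃≤ : ∀ {m} a b (r : Vec Bool m) → doubleZero a b + s₃ (a ∷ b ∷ r) ≤ 2 * suc m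
doubleZero+s₃≤ true  true  [] = ≤ᵇ⇒≤ _ _ tt
doubleZero+s₃≤ true  false [] = ≤ᵇ⇒≤ _ _ tt
doubleZero+s₃≤ false true  [] = ≤ᵇ⇒≤ _ _ tt
doubleZero+s₃≤ false false [] = ≤ᵇ⇒≤ _ _ tt
doubleZero+s₃≤ {suc m} a b (c ∷ r) = begin
    doubleZero a b + s₃ (a ∷ b ∷ c ∷ r)
  ≡⟨ cong (doubleZero a b +_) (s₃-∷ a b c r) ⟩
    doubleZero a b + (column a b c + s₃ (b ∷ c ∷ r))
  ≡⟨ swap (doubleZero a b) (column a b c) (s₃ (b ∷ c ∷ r)) ⟩
    (column a b c + doubleZero a b) + s₃ (b ∷ c ∷ r)
  ≤⟨ +-monoˡ-≤ (s₃ (b ∷ c ∷ r)) (column+doubleZero≤ a b c) ⟩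
    2 + (doubleZero b c + s₃ (b ∷ c ∷ r))
  ≤⟨ +-monoʳ-≤ 2 (doubleZero+s₃≤ b c r) ⟩
    2 + 2 * suc m
  ≡⟨ sym (*-suc 2 (suc m)) ⟩
    2 * suc (suc m)
  ∎
  where
  open ≤-Reasoning
  swap : ∀ p q s → p + (q + s) ≡ (q + p) + s
  swap = solve-∀

proposition7p7 : (n : ℕ) → 4 ≤ n → (x : Vec Bool n) → s₃ x ≤ 2 * n ∸ 2
proposition7p7 (suc (suc m)) (s≤s (s≤s _)) (a ∷ b ∷ r) = begin
    s₃ (a ∷ b ∷ r)
  ≤⟨ m≤n+m _ (doubleZero a b) ⟩
    doubleZero a b + s₃ (a ∷ b ∷ r)
  ≤⟨ doubleZero+s₃≤ a b r ⟩
    2 * suc m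
  ≡⟨ sym (m+n∸m≡n 2 (2 * suc m)) ⟩
    2 + 2 * suc m ∸ 2
  ≡⟨ cong (_∸ 2) (sym (*-suc 2 (suc m))) ⟩
    2 * suc (suc m) ∸ 2
  ∎
  where open ≤-Reasoning
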